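{- Every rule in $\mathcal{R}_l$ is progressing, connected and established.
   Context: Separation Logic: formulas from $x\not\approx x'$, $x\approx x'$, points-to atoms $x\mapsto(t_1..t_k)$, predicate atoms, $*$, $\vee$, $\exists$; an SID is a finite set of rules $p(x_1..x_n)\Leftarrow\pi$ with $\pi$ a quantifier-free separating conjunction of atoms; existential variables of a rule are those in $\mathrm{fv}(\pi)\setminus\{x_1..x_n\}$. Unfolding: replace an atom by an instance of a rule body (existentials fresh); predicate-less: no predicate atoms. $x$ is allocated by a symbolic heap if it contains equalities $x=v_1\approx\dots\approx v_k$ and an atom $v_k\mapsto(\dots)$. A rule $p(x_1..x_n)\Leftarrow\pi$ is progressing iff $\pi=x_1\mapsto(t_1..t_k)*\rho$ with no points-to atom in $\rho$; connected iff progressing and every predicate atom of $\rho$ has the form $q(t_i,\mathbf{u})$ for some $i$; established iff every existential variable is allocated by every predicate-less unfolding of $\pi$. $\mathcal{P}(\alpha)$: predicates reachable via rule bodies from those in $\alpha$. Standing setting: $\mathcal{R}$ is an SID with records of length $\kappa$ whose rules are all progressing; $\phi$ a formula and $\mathcal{P}_l=\mathcal{P}(\phi)$; $\mathbf{w}=(w_1..w_\nu)$, $\nu>0$, fixed variables not in $\mathcal{R}$; each rule of $\mathcal{R}$ has exactly $\mu$ existential variables; for $p\in\mathcal{P}_l$, in every rule $p(x_1..x_n)\Leftarrow\pi$ and every atom $q(x'_1..x'_m)$ in $\pi$, $x'_1\notin\{x_1..x_n\}$. Predicate $\mathsf{B}$ has the rule $\mathsf{B}(x)\Leftarrow x\mapsto(\bot,\dots,\bot)$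 with $\kappa+\nu+\mu$ fields. Decorations: for $n$-ary $p\in\mathcal{P}_l$, $X\subseteq\{1..n\}$, $p_X$ is a fresh $(n+\nu)$-ary predicate; a decoration of a formula replaces each atom $q(y_1..y_m)$ by some $q_Y(y_1..y_m,\mathbf{w})$, $Y\subseteq\{1..m\}$. $\mathrm{Dec}(\mathcal{R})$ consists of rules $p_X(x_1..x_n,\mathbf{w})\Leftarrow x_1\mapsto(y_1..y_\kappa,\mathbf{w},z_1..z_\mu)\sigma*\rho'*\mathop{*}_{i\in I}\mathsf{B}(z_i)$ with $p(x_1..x_n)\Leftarrow x_1\mapsto(y_1..y_\kappa)*\rho$ in $\mathcal{R}$, $X\subseteq\{1..n\}$, $\{z_1..z_\mu\}=(\mathrm{fv}(\rho)\cup\{y_1..y_\kappa\})\setminus\{x_1..x_n\}$, $\sigma$ a substitution with domain in $\{z_1..z_\mu\}$ and image in $\{x_1..x_n,w_1..w_\nu,z_1..z_\mu\}$, $\rho'$ a decoration of $\rho\sigma$, $I\subseteq\{1..\mu\}$ with $z_i\notin\mathrm{dom}(\sigma)$ for $i\in I$. $x\in\mathrm{Alloc}(\alpha)$ iff $\alpha$ contains $x\mapsto(\dots)$ or an atom $q_Y(x'_1..x'_{m+\nu})$ with $x'_i=x$, $i\in Y$. A rule $p_X(x_1..x_{n+\nu})\Leftarrow\pi$ of $\mathrm{Dec}(\mathcal{R})$ is well-defined iff $\{x_1\}\subseteq\mathrm{Alloc}(p_X(x_1..x_{n+\nu}))\subseteq\mathrm{Alloc}(\pi)$ and $\mathrm{fv}(\pi)\subseteq\mathrm{Alloc}(\pi)\cup\{x_1..x_{n+\nu}\}$.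 $\mathcal{R}_l$ is the set of well-defined rules of $\mathrm{Dec}(\mathcal{R})$ (together with the rule for $\mathsf{B}$). -}

module Defs where

open import Data.Nat using (ℕ; _≡ᵇ_; _+_; _<_)
open import Data.Bool using (Bool; true; false; if_then_else_)
open import Data.List using (List; []; _∷_; _++_; map; concatMap; length; zip; replicate; [_])
open import Data.List.Membership.Propositional using (_∈_; _∉_)
open import Data.List.Relation.Unary.All using (All)
open import Data.List.Relation.Unary.Any using (Any)
open import Data.List.Relation.Unary.Unique.Propositional using (Unique)
open import Data.List.Relation.Binary.Pointwise using (Pointwise)
open import Data.List.Relation.Binary.Permutation.Propositional using (_↭_)
open import Data.Product using (Σ; ∃; ∃-syntax; _×_; _,_)
open import Data.Sum using (_⊎_)
open import Data.Empty using (⊥)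
open import Data.Unit using (⊤)
open import Function using (_∘_)
open import Relation.Binary.PropositionalEquality using (_≡_)
open import Relation.Binary.Construct.Closure.ReflexiveTransitive using (Star)

Var : Set
Var = ℕ

-- terms occurring in records: variables and the constant ⊥ (nil)
data Term : Set where
  var : Var → Term
  nil : Term

-- predicate symbols: original predicates of R (named by ℕ),
-- decorated predicates p_X (X given by its characteristic vector over
-- positions 1..n of p), and the special predicate B.
data Sym : Set where
  orig  : ℕ → Sym
  dec   : ℕ → List Bool → Sym
  bpred : Sym

data Atom : Set where
  eqA  : Var → Var → Atom
  neqA : Var → Var → Atom
  pto  : Var → List Term → Atom
  pred : Sym → List Var → Atom

-- quantifier-free separating conjunction of atoms (symbolic heap)
Heap : Set
Heap = List Atom

data Formula : Set where
  atomF : Atom → Formula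
  _✱_   : Formula → Formula → Formula
  _∨F_  : Formula → Formula → Formula
  exF   : Var → Formula → Formula

record Rule : Set where
  constructor rule
  field
    head   : Sym
    params : List Var
    body   : Heap
open Rule public

SID : Set
SID = List Rule

fvTerm : Term → List Var
fvTerm (var x) = [ x ]
fvTerm nil     = []

fvTerms : List Term → List Var
fvTerms = concatMap fvTerm

fvAtom : Atom → List Var
fvAtom (eqA x y)   = x ∷ y ∷ []
fvAtom (neqA x y)  = x ∷ y ∷ []
fvAtom (pto x ts)  = x ∷ fvTerms ts
fvAtom (pred _ xs) = xs

fv : Heap → List Var
fv = concatMap fvAtom

substTerm : (Var → Var) → Term → Term
substTerm σ (var x) = var (σ x)
substTerm σ nil     = nil

substAtom : (Var → Var) → Atom → Atom
substAtom σ (eqA x y)   = eqA (σ x) (σ y)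
substAtom σ (neqA x y)  = neqA (σ x) (σ y)
substAtom σ (pto x ts)  = pto (σ x) (map (substTerm σ) ts)
substAtom σ (pred p xs) = pred p (map σ xs)

Existential : Rule → Var → Set
Existential r e = e ∈ fv (body r) × e ∉ params r

predsF : Formula → List Sym
predsF (atomF (pred p _)) = [ p ]
predsF (atomF _)          = []
predsF (φ ✱ ψ)            = predsF φ ++ predsF ψ
predsF (φ ∨F ψ)           = predsF φ ++ predsF ψ
predsF (exF _ φ)          = predsF φ

data Reach (R : SID) (φ : Formula) : ℕ → Set where
  base : ∀ {p} → orig p ∈ predsF φ → Reach R φ p
  step : ∀ {p q xs bd args} → Reach R φ p → rule (orig p) xs bd ∈ R →
         pred (orig q) args ∈ bd → Reach R φ q

data IsPto : Atom → Set where
  isPto : ∀ x ts → IsPto (pto x ts)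

NoPto : Heap → Set
NoPto ρ = All (λ a → IsPto a → ⊥) ρ

data IsPred : Atom → Set where
  isPred : ∀ p xs → IsPred (pred p xs)

PredicateLess : Heap → Set
PredicateLess π = All (λ a → IsPred a → ⊥) π

Progressing : Rule → Set
Progressing r = Σ Var λ x₁ → Σ (List Var) λ xs → params r ≡ x₁ ∷ xs ×
  Σ (List Term) λ ts → Σ Heap λ ρ → (body r ↭ (pto x₁ ts ∷ ρ)) × NoPto ρ

FirstArgIn : List Term → Atom → Set
FirstArgIn ts (pred q (a ∷ _)) = var a ∈ ts
FirstArgIn ts (pred q [])      = ⊥
FirstArgIn ts _                = ⊤

Connected : Rule → Set
Connected r = Progressing r × (Σ Var λ x₁ → Σ (List Var) λ xs → params r ≡ x₁ ∷ xs ×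
  Σ (List Term) λ ts → Σ Heap λ ρ → (body r ↭ (pto x₁ ts ∷ ρ)) × NoPto ρ ×
  All (FirstArgIn ts) ρ)

EqEdge : Heap → Var → Var → Set
EqEdge π a b = eqA a b ∈ π ⊎ eqA b a ∈ π

AllocatedBy : Heap → Var → Set
AllocatedBy π x = Σ Var λ y → Star (EqEdge π) x y × Σ (List Term) λ ts → pto y ts ∈ π

assoc : List Var → List Var → (Var → Var) → Var → Var
assoc []       _        f v = f v
assoc (x ∷ xs) []       f v = f v
assoc (x ∷ xs) (t ∷ ts) f v = if x ≡ᵇ v then t else assoc xs ts f v

data UnfoldStep (S : Rule → Set) (A : List Var) : Heap → Heap → Set where
  unfold : ∀ π₁ π₂ P ts xs bd (f : Var → Var) →
    S (rule P xs bd) → length xs ≡ length ts →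
    (∀ e → Existential (rule P xs bd) e → f e ∉ A × f e ∉ fv (π₁ ++ pred P ts ∷ π₂)) →
    (∀ e e' → Existential (rule P xs bd) e → Existential (rule P xs bd) e' →
       f e ≡ f e' → e ≡ e') →
    UnfoldStep S A (π₁ ++ pred P ts ∷ π₂)
                   (π₁ ++ map (substAtom (assoc xs ts f)) bd ++ π₂)

Unfolds : (Rule → Set) → List Var → Heap → Heap → Set
Unfolds S A = Star (UnfoldStep S A)

Established : (Rule → Set) → Rule → Set
Established S r = ∀ π' → Unfolds S (params r ++ fv (body r)) (body r) π' →
  PredicateLess π' → ∀ e → Existential r e → AllocatedBy π' e

data DecoratesAtom (ws : List Var) : Atom → Atom → Set where
  decPred : ∀ q ys (Y : List Bool) → length Y ≡ length ys →
            DecoratesAtom ws (pred (orig q) ys) (pred (dec q Y) (ys ++ ws))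
  keep    : ∀ a → (IsPred a → ⊥) → DecoratesAtom ws a a

Decoration : List Var → Heap → Heap → Set
Decoration ws ρ ρ' = Pointwise (DecoratesAtom ws) ρ ρ'

record DecRule (R : SID) (φ : Formula) (ws : List Var) (μ : ℕ) (r : Rule) : Set where
  field
    p   : ℕ
    x₁  : Var
    xs' : List Var
    bd  : Heap
    ys  : List Term
    ρ   : Heap
    inR     : rule (orig p) (x₁ ∷ xs') bd ∈ R
    inPl    : Reach R φ p
    shape   : bd ↭ (pto x₁ ys ∷ ρ)
    ρNoPto  : NoPto ρ
    X       : List Bool
    Xlen    : length X ≡ length (x₁ ∷ xs')
    zs      : List Var
    zsUniq  : Unique zs
    zsLen   : length zs ≡ μ
    zsDef₁  : ∀ v → v ∈ zs → (v ∈ fv ρ ⊎ v ∈ fvTerms ys) × v ∉ (x₁ ∷ xs')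
    zsDef₂  : ∀ v → (v ∈ fv ρ ⊎ v ∈ fvTerms ys) → v ∉ (x₁ ∷ xs') → v ∈ zs
    σ       : Var → Var
    σdom    : ∀ v → v ∉ zs → σ v ≡ v
    σimg    : ∀ v → v ∈ zs → σ v ∈ (x₁ ∷ xs') ++ ws ++ zs
    ρ'      : Heap
    ρ'dec   : Decoration ws (map (substAtom σ) ρ) ρ'
    I       : List Var
    IUniq   : Unique I
    Iok     : All (λ z → z ∈ zs × σ z ≡ z) I
    isRule  : r ≡ rule (dec p X) ((x₁ ∷ xs') ++ ws)
                (pto x₁ (map (substTerm σ) ys ++ map var ws ++ map (var ∘ σ) zs)
                 ∷ ρ' ++ map (λ z → pred bpred [ z ]) I)

AllocAtom : Atom → Var → Set
AllocAtom (pto x _)             y = x ≡ y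
AllocAtom (pred (dec q Y) args) y = (true , y) ∈ zip Y args
AllocAtom (pred bpred (a ∷ _))  y = a ≡ y
AllocAtom _                     y = ⊥

Alloc : Heap → Var → Set
Alloc π y = Any (λ a → AllocAtom a y) π

WellDefined : Rule → Set
WellDefined (rule h xs π) =
  (Σ Var λ x₁ → Σ (List Var) λ rest → xs ≡ x₁ ∷ rest × Alloc [ pred h xs ] x₁) ×
  (∀ y → Alloc [ pred h xs ] y → Alloc π y) ×
  (∀ y → y ∈ fv π → Alloc π y ⊎ y ∈ xs)

Brule : ℕ → Var → Rule
Brule n b = rule bpred [ b ] [ pto b (replicate n nil) ]

Rl : SID → Formula → ℕ → List Var → ℕ → Rule → Set
Rl R φ κ ws μ r =
  (DecRule R φ ws μ r × WellDefined r) ⊎ (Σ Var λ b → r ≡ Brule (κ + length ws + μ) b)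

data OrigSym : Sym → Set where
  isOrig : ∀ p → OrigSym (orig p)

OrigAtom : Atom → Set
OrigAtom (pred q _) = OrigSym q
OrigAtom _          = ⊤

record Setting (R : SID) (φ : Formula) (κ : ℕ) (ws : List Var) (μ : ℕ) : Set where
  field
    -- R only uses original predicate symbols (p_X and B are fresh)
    origHead   : ∀ r → r ∈ R → OrigSym (head r)
    origBody   : ∀ r → r ∈ R → All OrigAtom (body r)
    paramsUniq : ∀ r → r ∈ R → Unique (params r)
    recLen     : ∀ r x ts → r ∈ R → pto x ts ∈ body r → length ts ≡ κ
    progR      : ∀ r → r ∈ R → Progressing r
    νpos       : 0 < length ws
    wsUniq     : Unique ws
    wsFresh    : ∀ r w → r ∈ R → w ∈ ws → w ∉ params r × w ∉ fv (body r)
    exCount    : ∀ r → r ∈ R → Σ (List Var) λ es → Unique es × length es ≡ μ ×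
                   (∀ v → v ∈ es → Existential r v) × (∀ v → Existential r v → v ∈ es)
    firstArg   : ∀ p xs bd q x' args → rule (orig p) xs bd ∈ R → Reach R φ p →
                   pred q (x' ∷ args) ∈ bd → x' ∉ xs

module Submission where

open import Defs
open import Data.Nat using (ℕ; zero; suc; _<_)
open import Data.Nat.Properties using (≡ᵇ⇒≡; ≡⇒≡ᵇ; suc-injective)
open import Data.Bool using (Bool)
open import Data.Bool.Properties using (T-≡; ¬-not)
open import Data.List using (List; []; _∷_; _++_; map; length; zip; replicate; [_])
open import Data.List.Membership.Propositional using (_∈_; find; lose)
open import Data.List.Membership.Propositional.Properties using (∈-map⁺; ∈-concatMap⁺)
open import Data.List.Relation.Unary.All as All using (All; []; _∷_)
import Data.List.Relation.Unary.All.Properties as All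
open import Data.List.Relation.Unary.Any using (here; there)
import Data.List.Relation.Unary.Any as Any
import Data.List.Relation.Unary.Any.Properties as Any
open import Data.List.Relation.Unary.AllPairs using ([]; _∷_)
open import Data.List.Relation.Unary.Unique.Propositional using (Unique)
import Data.List.Relation.Unary.Unique.Propositional.Properties as Unique
open import Data.List.Relation.Binary.Pointwise using (Pointwise; []; _∷_)
open import Data.List.Relation.Binary.Permutation.Propositional using (↭-refl; ↭-sym)
open import Data.List.Relation.Binary.Permutation.Propositional.Properties using (∈-resp-↭)
open import Data.Product using (∃-syntax; _×_; _,_; proj₁)
open import Data.Sum using (_⊎_; inj₁; inj₂)
open import Data.Empty using (⊥-elim)
open import Data.Unit using (⊤; tt)
open import Function using (_∘_; Equivalence)
open import Relation.Nullary using (¬_; contradiction)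
open import Relation.Binary.PropositionalEquality using (_≡_; _≢_; refl; cong; trans; subst)
open import Relation.Binary.Construct.Closure.ReflexiveTransitive using (ε; _◅_)

-- Progressing and connected hold by construction of Dec(R): the body is
-- x₁ ↦ (…) * ρ' * B(zᵢ)…, and each predicate atom of ρ' starts with σ z for
-- an existential z of the original rule (the standing assumption on first
-- arguments), which is a record field, or — for an argument-less atom of R —
-- with w₁.  Established follows from well-definedness: every existential lies
-- in Alloc of the body, unfolding a rule of R_l never loses a variable of
-- Alloc because the head's allocations are allocated by the instantiated body,
-- and in a predicate-less heap Alloc means a points-to atom.

All-transport : ∀ {A B : Set} {P : A → Set} {Q : B → Set} {_∼_ : A → B → Set} →
  (∀ {a b} → P a → a ∼ b → Q b) →
  ∀ {as bs} → All P as → Pointwise _∼_ as bs → All Q bs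
All-transport f [] [] = []
All-transport f (pa ∷ pas) (a∼b ∷ as∼bs) = f pa a∼b ∷ All-transport f pas as∼bs

assoc-head : ∀ x xs t ts f → assoc (x ∷ xs) (t ∷ ts) f x ≡ t
assoc-head x xs t ts f rewrite Equivalence.to T-≡ (≡⇒≡ᵇ x x refl) = refl

assoc-tail : ∀ {x y} xs t ts f → x ≢ y → assoc (x ∷ xs) (t ∷ ts) f y ≡ assoc xs ts f y
assoc-tail {x} {y} xs t ts f x≢y
  rewrite ¬-not (x≢y ∘ ≡ᵇ⇒≡ x y ∘ Equivalence.from T-≡) = refl

∈-zip⇒∈ : ∀ {b y} (Y : List Bool) (xs : List Var) → (b , y) ∈ zip Y xs → y ∈ xs
∈-zip⇒∈ (_ ∷ Y) (x ∷ xs) (here refl) = here refl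
∈-zip⇒∈ (_ ∷ Y) (x ∷ xs) (there p) = there (∈-zip⇒∈ Y xs p)

∈-zip-map⁺ : ∀ {b y} (τ : Var → Var) (Y : List Bool) (xs : List Var) →
  (b , y) ∈ zip Y xs → (b , τ y) ∈ zip Y (map τ xs)
∈-zip-map⁺ τ (_ ∷ Y) (x ∷ xs) (here refl) = here refl
∈-zip-map⁺ τ (_ ∷ Y) (x ∷ xs) (there p) = there (∈-zip-map⁺ τ Y xs p)

∈-zip-assoc⁻ : ∀ {b e} (Y : List Bool) {xs ts} f → Unique xs → length xs ≡ length ts →
  (b , e) ∈ zip Y ts → ∃[ y ] (b , y) ∈ zip Y xs × assoc xs ts f y ≡ e
∈-zip-assoc⁻ (_ ∷ Y) {x ∷ xs} {t ∷ ts} f _ _ (here refl) =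
  x , here refl , assoc-head x xs t ts f
∈-zip-assoc⁻ (_ ∷ Y) {x ∷ xs} {t ∷ ts} f (x∉xs ∷ xs!) len (there e∈)
  with ∈-zip-assoc⁻ Y f xs! (suc-injective len) e∈
... | y , y∈ , eq =
  y , there y∈ , trans (assoc-tail xs t ts f (All.lookup x∉xs (∈-zip⇒∈ Y xs y∈))) eq
∈-zip-assoc⁻ (_ ∷ Y) {[]} {_ ∷ _} f _ () _

allocAtom-subst : ∀ τ a {y} → AllocAtom a y → AllocAtom (substAtom τ a) (τ y)
allocAtom-subst τ (pto x ts) eq = cong τ eq
allocAtom-subst τ (pred (dec q Y) args) y∈ = ∈-zip-map⁺ τ Y args y∈
allocAtom-subst τ (pred bpred (a ∷ _)) eq = cong τ eq

alloc-subst : ∀ τ π {y} → Alloc π y → Alloc (map (substAtom τ) π) (τ y)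
alloc-subst τ π y∈ = Any.map⁺ (Any.map (λ {a} → allocAtom-subst τ a) y∈)

allocAtom-assoc⁻ : ∀ h {xs ts} f {e} → Unique xs → length xs ≡ length ts →
  AllocAtom (pred h ts) e → ∃[ y ] AllocAtom (pred h xs) y × assoc xs ts f y ≡ e
allocAtom-assoc⁻ (orig q) f _ _ ()
allocAtom-assoc⁻ (dec q Y) f xs! len e∈ = ∈-zip-assoc⁻ Y f xs! len e∈
allocAtom-assoc⁻ bpred {x ∷ xs} {t ∷ ts} f _ _ refl = x , refl , assoc-head x xs t ts f
allocAtom-assoc⁻ bpred {[]} {_ ∷ _} f _ () _

HeadAllocInBody : Rule → Set
HeadAllocInBody r = ∀ y → Alloc [ pred (head r) (params r) ] y → Alloc (body r) y

alloc-instantiate : ∀ {h xs bd ts} f {e} → Unique xs → HeadAllocInBody (rule h xs bd) →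
  length xs ≡ length ts → AllocAtom (pred h ts) e →
  Alloc (map (substAtom (assoc xs ts f)) bd) e
alloc-instantiate {h} {xs} {bd} {ts} f xs! covers len e∈
  with allocAtom-assoc⁻ h f xs! len e∈
... | y , y∈ , refl = alloc-subst (assoc xs ts f) bd (covers y (here y∈))

AllocMonotone : (Rule → Set) → Set
AllocMonotone S = ∀ r → S r → Unique (params r) × HeadAllocInBody r

module _ {S : Rule → Set} (mono : AllocMonotone S) where

  unfoldStep-alloc : ∀ {A π π' e} → UnfoldStep S A π π' → Alloc π e → Alloc π' e
  unfoldStep-alloc (unfold π₁ π₂ P ts xs bd f r∈S len _ _) e∈ with Any.++⁻ π₁ e∈
  ... | inj₁ e∈π₁ = Any.++⁺ˡ e∈π₁
  ... | inj₂ (there e∈π₂) = Any.++⁺ʳ π₁ (Any.++⁺ʳ _ e∈π₂)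
  ... | inj₂ (here e∈atom) with mono _ r∈S
  ...   | xs! , covers = Any.++⁺ʳ π₁ (Any.++⁺ˡ (alloc-instantiate f xs! covers len e∈atom))

  unfolds-alloc : ∀ {A π π' e} → Unfolds S A π π' → Alloc π e → Alloc π' e
  unfolds-alloc ε e∈ = e∈
  unfolds-alloc (s ◅ ss) e∈ = unfolds-alloc ss (unfoldStep-alloc s e∈)

allocAtom⇒pto : ∀ a {e} → ¬ IsPred a → AllocAtom a e → ∃[ ts ] a ≡ pto e ts
allocAtom⇒pto (pto x ts) _ refl = ts , refl
allocAtom⇒pto (pred s xs) ¬pred _ = ⊥-elim (¬pred (isPred s xs))

predicateLess-allocatedBy : ∀ {π e} → PredicateLess π → Alloc π e → AllocatedBy π e
predicateLess-allocatedBy pl e∈ with find e∈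
... | a , a∈π , e∈a with allocAtom⇒pto a (All.lookup pl a∈π) e∈a
...   | ts , refl = _ , ε , ts , a∈π

alloc⇒established : ∀ {S r} → AllocMonotone S →
  (∀ e → Existential r e → Alloc (body r) e) → Established S r
alloc⇒established mono ex-alloc π' unf pl e e-ex =
  predicateLess-allocatedBy pl (unfolds-alloc mono unf (ex-alloc e e-ex))

wellDefined-headAllocInBody : ∀ r → WellDefined r → HeadAllocInBody r
wellDefined-headAllocInBody r (_ , covers , _) = covers

wellDefined-existential-alloc : ∀ r {e} → WellDefined r → Existential r e → Alloc (body r) e
wellDefined-existential-alloc r (_ , _ , closed) (e∈ , e∉) with closed _ e∈
... | inj₁ e-alloc = e-alloc
... | inj₂ e∈params = contradiction e∈params e∉

FirstArgSatisfies : (Var → Set) → Atom → Set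
FirstArgSatisfies P (pred _ (v ∷ _)) = P v
FirstArgSatisfies P _ = ⊤

firstArgSatisfies-subst : ∀ {P} σ a → FirstArgSatisfies (P ∘ σ) a →
  FirstArgSatisfies P (substAtom σ a)
firstArgSatisfies-subst σ (eqA x y) _ = tt
firstArgSatisfies-subst σ (neqA x y) _ = tt
firstArgSatisfies-subst σ (pto x ts) _ = tt
firstArgSatisfies-subst σ (pred q []) _ = tt
firstArgSatisfies-subst σ (pred q (v ∷ vs)) Pσv = Pσv

decorates-firstArgIn : ∀ {ws ts a a'} → 0 < length ws → All (λ w → var w ∈ ts) ws →
  FirstArgSatisfies (λ v → var v ∈ ts) a → DecoratesAtom ws a a' → FirstArgIn ts a'
decorates-firstArgIn _ (w∈ ∷ _) _ (decPred q [] Y _) = w∈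
decorates-firstArgIn () [] _ (decPred q [] Y _)
decorates-firstArgIn _ _ v∈ (decPred q (v ∷ vs) Y _) = v∈
decorates-firstArgIn _ _ _ (keep (eqA x y) _) = tt
decorates-firstArgIn _ _ _ (keep (neqA x y) _) = tt
decorates-firstArgIn _ _ _ (keep (pto x us) _) = tt
decorates-firstArgIn _ _ _ (keep (pred s xs) ¬pred) = ⊥-elim (¬pred (isPred s xs))

substAtom-¬pto : ∀ σ a → ¬ IsPto a → ¬ IsPto (substAtom σ a)
substAtom-¬pto σ (pto x ts) ¬pto _ = ¬pto (isPto x ts)

decorates-¬pto : ∀ {ws a a'} → ¬ IsPto a → DecoratesAtom ws a a' → ¬ IsPto a'
decorates-¬pto _ (decPred q ys Y _) ()
decorates-¬pto ¬pto (keep a _) = ¬pto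

decoration-noPto : ∀ {ws} σ {ρ ρ'} → NoPto ρ → Decoration ws (map (substAtom σ) ρ) ρ' →
  NoPto ρ'
decoration-noPto σ noPto =
  All-transport decorates-¬pto (All.map⁺ (All.map (λ {a} → substAtom-¬pto σ a) noPto))

fvTerms-replicate-nil : ∀ n → fvTerms (replicate n nil) ≡ []
fvTerms-replicate-nil zero = refl
fvTerms-replicate-nil (suc n) = fvTerms-replicate-nil n

Brule-wellDefined : ∀ n b → WellDefined (Brule n b)
Brule-wellDefined n b = (b , [] , refl , here refl) , (λ { _ (here refl) → here refl }) , closed
  where
  closed : ∀ y → y ∈ fv (body (Brule n b)) → Alloc (body (Brule n b)) y ⊎ y ∈ [ b ]
  closed y y∈ rewrite fvTerms-replicate-nil n = inj₂ y∈

Brule-connected : ∀ n b → Connected (Brule n b)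
Brule-connected n b =
  (b , [] , refl , replicate n nil , [] , ↭-refl , []) ,
  (b , [] , refl , replicate n nil , [] , ↭-refl , [] , [])

module _ {R φ κ ws μ} (setting : Setting R φ κ ws μ) where
  open Setting setting

  decRule-uniqueParams : ∀ {r} → DecRule R φ ws μ r → Unique (params r)
  decRule-uniqueParams d rewrite DecRule.isRule d =
    Unique.++⁺ (paramsUniq _ (DecRule.inR d)) wsUniq
      (λ (v∈ , v∈ws) → proj₁ (wsFresh _ _ (DecRule.inR d) v∈ws) v∈)

  decRule-connected : ∀ {r} → DecRule R φ ws μ r → Connected r
  decRule-connected d rewrite DecRule.isRule d =
    (x₁ , xs' ++ ws , refl , record′ , _ , ↭-refl , noPto) ,
    (x₁ , xs' ++ ws , refl , record′ , _ , ↭-refl , noPto , firstArgs)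
    where
    open DecRule d
    record′ : List Term
    record′ = map (substTerm σ) ys ++ map var ws ++ map (var ∘ σ) zs

    ws-inRecord : All (λ w → var w ∈ record′) ws
    ws-inRecord = All.tabulate (λ w∈ → Any.++⁺ʳ (map (substTerm σ) ys) (Any.++⁺ˡ (∈-map⁺ var w∈)))

    σzs-inRecord : ∀ {z} → z ∈ zs → var (σ z) ∈ record′
    σzs-inRecord z∈ = Any.++⁺ʳ (map (substTerm σ) ys) (Any.++⁺ʳ (map var ws) (∈-map⁺ (var ∘ σ) z∈))

    ρ-firstArgs : ∀ {a} → a ∈ ρ → FirstArgSatisfies (λ v → var (σ v) ∈ record′) a
    ρ-firstArgs {eqA x y} _ = tt
    ρ-firstArgs {neqA x y} _ = tt
    ρ-firstArgs {pto x us} _ = tt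
    ρ-firstArgs {pred q []} _ = tt
    ρ-firstArgs {pred q (v ∷ vs)} a∈ = σzs-inRecord (zsDef₂ v
      (inj₁ (∈-concatMap⁺ fvAtom (lose a∈ (here refl))))
      (firstArg p _ bd q v vs inR inPl (∈-resp-↭ (↭-sym shape) (there a∈))))

    noPto : NoPto (ρ' ++ map (λ z → pred bpred [ z ]) I)
    noPto = All.++⁺ (decoration-noPto σ ρNoPto ρ'dec) (All.map⁺ (All.universal (λ _ ()) I))

    firstArgs : All (FirstArgIn record′) (ρ' ++ map (λ z → pred bpred [ z ]) I)
    firstArgs = All.++⁺
      (All-transport (decorates-firstArgIn νpos ws-inRecord)
        (All.map⁺ (All.tabulate (λ {a} a∈ → firstArgSatisfies-subst σ a (ρ-firstArgs a∈))))
        ρ'dec)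
      (All.map⁺ (All.map (λ (z∈ , σz≡z) → subst (λ u → var u ∈ record′) σz≡z (σzs-inRecord z∈)) Iok))

  Rl-wellDefined : ∀ {r} → Rl R φ κ ws μ r → WellDefined r
  Rl-wellDefined (inj₁ (_ , wd)) = wd
  Rl-wellDefined (inj₂ (b , refl)) = Brule-wellDefined _ b

  Rl-uniqueParams : ∀ {r} → Rl R φ κ ws μ r → Unique (params r)
  Rl-uniqueParams (inj₁ (d , _)) = decRule-uniqueParams d
  Rl-uniqueParams (inj₂ (b , refl)) = [] ∷ []

  Rl-allocMonotone : AllocMonotone (Rl R φ κ ws μ)
  Rl-allocMonotone r r∈ = Rl-uniqueParams r∈ , wellDefined-headAllocInBody r (Rl-wellDefined r∈)

  Rl-connected : ∀ {r} → Rl R φ κ ws μ r → Connected r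
  Rl-connected (inj₁ (d , _)) = decRule-connected d
  Rl-connected (inj₂ (b , refl)) = Brule-connected _ b

  Rl-established : ∀ {r} → Rl R φ κ ws μ r → Established (Rl R φ κ ws μ) r
  Rl-established {r} r∈ =
    alloc⇒established {r = r} Rl-allocMonotone (λ e → wellDefined-existential-alloc r (Rl-wellDefined r∈))

lemma8 : (R : SID) (φ : Formula) (κ : ℕ) (ws : List Var) (μ : ℕ) →
    Setting R φ κ ws μ →
    ∀ r → Rl R φ κ ws μ r →
    Progressing r × Connected r × Established (Rl R φ κ ws μ) r
lemma8 R φ κ ws μ setting r r∈ =
  proj₁ (Rl-connected setting r∈) , Rl-connected setting r∈ , Rl-established setting r∈
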